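{- Let $G$ be a multi-hypergraph all of whose edges have size 1 (loops) or size 2, such that each vertex lies in at most one loop (while edges of size 2 may have arbitrary multiplicity). Then $\operatorname{ex}(G,\mathcal{D})\geq\frac{2}{3}e(G)$.
   Context: $\mathcal{D}$ is the dumbbell hypergraph with vertex set $\{u,v\}$ and edges $\{u\},\{v\},\{u,v\}$. $\operatorname{ex}(G,\mathcal{D})$ is the maximum number of edges (with multiplicity) of a sub-hypergraph of $G$ containing no copy of $\mathcal{D}$, i.e., no two vertices $x,y$ each carrying a loop and joined by an edge of size 2. -}

module Defs where

open import Data.Nat using (ℕ; _≤_)
open import Data.Fin using (Fin)
open import Data.List using (List; length; filter)
open import Data.List.Membership.Propositional using (_∈_)
open import Data.Product using (Σ; ∃; ∃-syntax; _×_)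
open import Relation.Binary.PropositionalEquality using (_≡_; _≢_)
open import Relation.Nullary using (¬_; Dec; yes; no)
import Data.Fin as F

data Edge (n : ℕ) : Set where
  loop : Fin n → Edge n
  pair : (u v : Fin n) → u ≢ v → Edge n

-- A multi-hypergraph is given by its list of edges (multiplicity = number of
-- occurrences in the list).
Hypergraph : ℕ → Set
Hypergraph n = List (Edge n)

e : ∀ {n} → Hypergraph n → ℕ
e = length

IsLoopAt : ∀ {n} → Fin n → Edge n → Set
IsLoopAt v (loop w) = w ≡ v
IsLoopAt v (pair _ _ _) = Data.Empty.⊥
  where import Data.Empty

isLoopAt? : ∀ {n} (v : Fin n) (x : Edge n) → Dec (IsLoopAt v x)
isLoopAt? v (loop w) = w F.≟ v
isLoopAt? v (pair _ _ _) = no (λ ())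

loopCount : ∀ {n} → Fin n → Hypergraph n → ℕ
loopCount v G = length (filter (isLoopAt? v) G)

AtMostOneLoop : ∀ {n} → Hypergraph n → Set
AtMostOneLoop {n} G = (v : Fin n) → loopCount v G ≤ 1

-- the edge is a 2-edge with endpoints x and y (in this order; the
-- dumbbell predicate below quantifies over both orders)
IsPairOn : ∀ {n} → Fin n → Fin n → Edge n → Set
IsPairOn x y (loop _) = Data.Empty.⊥
  where import Data.Empty
IsPairOn x y (pair u v _) = (u ≡ x) × (v ≡ y)

-- H contains a copy of the dumbbell D: two vertices x, y each carrying a
-- loop and joined by an edge of size 2.
ContainsDumbbell : ∀ {n} → Hypergraph n → Set
ContainsDumbbell {n} H =
  Σ (Fin n) λ x → Σ (Fin n) λ y →
    (loop x ∈ H) × (loop y ∈ H) × (∃[ f ] ((f ∈ H) × IsPairOn x y f))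

DumbbellFree : ∀ {n} → Hypergraph n → Set
DumbbellFree H = ¬ ContainsDumbbell H

-- Pick a set S of vertices and keep the loops at S together with every 2-edge
-- having an end outside S; this never contains a dumbbell.  S is built greedily,
-- one vertex v at a time, retiring the ℓ ≤ 1 loops and d 2-edges at v:
--   * if d ≥ 2ℓ, put v outside S; the d ≥ ⅔ (ℓ + d) retired 2-edges are kept;
--   * if ℓ = 1 and d = 0, put v in S; its loop is kept;
--   * if ℓ = d = 1 with 2-edge vw, put w outside S and v in S, retiring the edges
--     at w and then the loop at v: of these ℓ_w + d_w + 1 ≤ d_w + 2 edges, all
--     but the loop at w are kept, and d_w + 1 ≥ ⅔ (d_w + 2) as d_w ≥ 1.
module Submission where

open import Defs
open import Data.Nat using (ℕ; _*_; _≤_)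
open import Data.Product using (Σ; _×_)
open import Data.List.Relation.Binary.Sublist.Propositional using (_⊆_)

open import Level using (Level; 0ℓ)
open import Data.Bool using (Bool; true; false; T)
open import Data.Empty using (⊥)
open import Data.Fin using (Fin; _≟_)
open import Data.Nat using (suc; _+_; _<_; z≤n; s≤s; s≤s⁻¹)
open import Data.Nat.Properties
  using (+-suc; +-identityʳ; *-distribˡ-+; ≤-refl; ≤-reflexive; ≤-trans; n≤1+n; n≤0⇒n≡0;
         +-mono-≤; +-monoˡ-≤; +-monoʳ-≤; *-monoʳ-≤; module ≤-Reasoning)
open import Data.Nat.Tactic.RingSolver using (solve-∀)
open import Data.List using (List; []; _∷_; length; filter; allFin)
open import Data.List.Properties using (filter-≐; filter-none; filter-some; filter-all)
open import Data.List.Membership.Propositional using (_∈_; lose)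
open import Data.List.Membership.Propositional.Properties using (∈-allFin; ∈-filter⁻)
open import Data.List.Relation.Unary.Any as Any using (Any; here; there)
open import Data.List.Relation.Unary.Any.Properties using (¬Any[])
open import Data.List.Relation.Unary.All using (universal; universal-U)
open import Data.List.Relation.Binary.Sublist.Propositional using (⊆-refl)
open import Data.List.Relation.Binary.Sublist.Propositional.Properties
  using (filter⁺; filter-⊆; length-mono-≤)
open import Data.Product using (_,_; proj₂; ∃-syntax)
open import Data.Sum using (_⊎_; inj₁; inj₂; fromInj₂)
import Data.Sum as Sum
open import Data.Vec.Functional using (updateAt)
open import Data.Vec.Functional.Properties using (updateAt-updates; updateAt-minimal)
open import Function using (_∘_; const; flip)
open import Relation.Binary.PropositionalEquality
  using (_≡_; _≢_; refl; sym; trans; cong; subst; subst₂)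
open import Relation.Nullary using (¬_; yes; no; does; ¬?; contradiction)
open import Relation.Nullary.Decidable using (T?; _×-dec_; _⊎-dec_)
open import Relation.Unary using (Pred; Decidable; _∩_; _∪_; ∁; _≐_)
open import Relation.Unary.Properties using (_∩?_; _∪?_; ∁?; U?)
import Relation.Unary as Unary

module _ {a} {A : Set a} where

  private variable
    p q r : Level
    P : Pred A p
    Q : Pred A q
    S : Pred A r

  count : Decidable P → List A → ℕ
  count P? = length ∘ filter P?

  count-split : (P? : Decidable P) (Q? : Decidable Q) (xs : List A) →
                count P? xs ≡ count (P? ∩? Q?) xs + count (P? ∩? ∁? Q?) xs
  count-split P? Q? [] = refl
  count-split P? Q? (x ∷ xs) with does (P? x) | does (Q? x)
  ... | true  | true  = cong suc (count-split P? Q? xs)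
  ... | true  | false = trans (cong suc (count-split P? Q? xs)) (sym (+-suc _ _))
  ... | false | _     = count-split P? Q? xs

  count-mono : (P? : Decidable P) (Q? : Decidable Q) → P Unary.⊆ Q →
               (xs : List A) → count P? xs ≤ count Q? xs
  count-mono P? Q? P⊆Q xs = length-mono-≤ (filter⁺ P? Q? (λ { refl → P⊆Q }) (⊆-refl {x = xs}))

  count-≐ : (P? : Decidable P) (Q? : Decidable Q) → P ≐ Q →
            (xs : List A) → count P? xs ≡ count Q? xs
  count-≐ P? Q? P≐Q = cong length ∘ filter-≐ P? Q? P≐Q

  count-≤-+ : (P? : Decidable P) (Q? : Decidable Q) (S? : Decidable S) → P Unary.⊆ Q ∪ S →
              (xs : List A) → count P? xs ≤ count Q? xs + count S? xs
  count-≤-+ {P = P} {Q = Q} {S = S} P? Q? S? P⊆Q∪S xs = begin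
    count P? xs                                   ≡⟨ count-split P? Q? xs ⟩
    count (P? ∩? Q?) xs + count (P? ∩? ∁? Q?) xs  ≤⟨ +-mono-≤ (count-mono _ Q? proj₂ xs)
                                                              (count-mono _ S? outside-Q xs) ⟩
    count Q? xs + count S? xs                     ∎
    where
    open ≤-Reasoning
    outside-Q : P ∩ ∁ Q Unary.⊆ S
    outside-Q (px , ¬qx) = fromInj₂ (flip contradiction ¬qx) (P⊆Q∪S px)

  count-none : (P? : Decidable P) → (∀ {x} → ¬ P x) → (xs : List A) → count P? xs ≡ 0
  count-none P? ¬P xs = cong length (filter-none P? (universal (λ _ → ¬P) xs))

  count-witness : (P? : Decidable P) (xs : List A) → 0 < count P? xs → ∃[ x ] x ∈ xs × P x
  count-witness P? (x ∷ xs) pos with P? x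
  ... | yes px = x , here refl , px
  ... | no _ with count-witness P? xs pos
  ...   | y , y∈xs , py = y , there y∈xs , py

  count-∩∁≡0 : (P? : Decidable P) (Q? : Decidable Q) {xs : List A} {x : A} →
               count P? xs ≤ 1 → x ∈ xs → P x → Q x → count (P? ∩? ∁? Q?) xs ≡ 0
  count-∩∁≡0 {P = P} {Q = Q} P? Q? {xs} P≤1 x∈xs px qx = n≤0⇒n≡0 (s≤s⁻¹ (begin
    1 + count (P? ∩? ∁? Q?) xs                    ≤⟨ +-monoˡ-≤ _ (filter-some (P? ∩? Q?) some-P∩Q) ⟩
    count (P? ∩? Q?) xs + count (P? ∩? ∁? Q?) xs  ≡⟨ count-split P? Q? xs ⟨
    count P? xs                                   ≤⟨ P≤1 ⟩
    1                                             ∎))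
    where
    open ≤-Reasoning
    some-P∩Q : Any (P ∩ Q) xs
    some-P∩Q = lose x∈xs (px , qx)

combine : ∀ {x y u w c c′} → 2 * x + c ≤ 3 * u + c′ → 2 * y + c′ ≤ 3 * w →
          2 * (x + y) + c ≤ 3 * (u + w)
combine {x} {y} {u} {w} {c} {c′} first second = begin
  2 * (x + y) + c       ≡⟨ distribute x y c ⟩
  (2 * x + c) + 2 * y   ≤⟨ +-monoˡ-≤ (2 * y) first ⟩
  (3 * u + c′) + 2 * y  ≡⟨ exchange (3 * u) c′ (2 * y) ⟩
  3 * u + (2 * y + c′)  ≤⟨ +-monoʳ-≤ (3 * u) second ⟩
  3 * u + 3 * w         ≡⟨ *-distribˡ-+ 3 u w ⟨
  3 * (u + w)           ∎
  where
  open ≤-Reasoning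
  distribute : ∀ x y c → 2 * (x + y) + c ≡ (2 * x + c) + 2 * y
  distribute = solve-∀
  exchange : ∀ a b c → (a + b) + c ≡ a + (c + b)
  exchange = solve-∀

drop-arith : ∀ {ℓ d} → 2 * ℓ ≤ d → 2 * (ℓ + d) + 0 ≤ 3 * d + 0
drop-arith {ℓ} {d} 2ℓ≤d = begin
  2 * (ℓ + d) + 0  ≡⟨ distribute ℓ d ⟩
  2 * ℓ + 2 * d    ≤⟨ +-monoˡ-≤ (2 * d) 2ℓ≤d ⟩
  d + 2 * d        ≡⟨ collect d ⟩
  3 * d + 0        ∎
  where
  open ≤-Reasoning
  distribute : ∀ ℓ d → 2 * (ℓ + d) + 0 ≡ 2 * ℓ + 2 * d
  distribute = solve-∀
  collect : ∀ d → d + 2 * d ≡ 3 * d + 0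
  collect = solve-∀

neighbour-arith : ∀ {ℓ d} → ℓ ≤ 1 → 1 ≤ d → 2 * (ℓ + d) + 0 ≤ 3 * d + 1
neighbour-arith {ℓ} {d} ℓ≤1 1≤d = begin
  2 * (ℓ + d) + 0    ≤⟨ +-monoˡ-≤ 0 (*-monoʳ-≤ 2 (+-monoˡ-≤ d ℓ≤1)) ⟩
  2 * (1 + d) + 0    ≡⟨ split-off d ⟩
  1 + (1 + 2 * d)    ≤⟨ +-monoʳ-≤ 1 (+-monoˡ-≤ (2 * d) 1≤d) ⟩
  1 + (d + 2 * d)    ≡⟨ collect d ⟩
  3 * d + 1          ∎
  where
  open ≤-Reasoning
  split-off : ∀ d → 2 * (1 + d) + 0 ≡ 1 + (1 + 2 * d)
  split-off = solve-∀
  collect : ∀ d → 1 + (d + 2 * d) ≡ 3 * d + 1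
  collect = solve-∀

pendant-arith : ∀ {ℓ d} → ℓ ≡ 1 → d ≡ 0 → 2 * (ℓ + d) + 1 ≤ 3 * ℓ + 0
pendant-arith refl refl = ≤-refl

loop-degree-cases : ∀ ℓ d → ℓ ≤ 1 →
                    2 * (ℓ + d) + 0 ≤ 3 * d + 0 ⊎ 2 * (ℓ + d) + 0 ≤ 3 * ℓ + 0 ⊎ (ℓ ≡ 1 × d ≡ 1)
loop-degree-cases 0             d             _        = inj₁ (drop-arith {0} {d} z≤n)
loop-degree-cases 1             0             _        = inj₂ (inj₁ (n≤1+n 2))
loop-degree-cases 1             1             _        = inj₂ (inj₂ (refl , refl))
loop-degree-cases 1             (suc (suc _)) _        = inj₁ (drop-arith {1} (s≤s (s≤s z≤n)))
loop-degree-cases (suc (suc _)) _             (s≤s ())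

module _ {n : ℕ} where

  IsPairAt : Fin n → Pred (Edge n) 0ℓ
  IsPairAt v (loop _)     = ⊥
  IsPairAt v (pair a b _) = a ≡ v ⊎ b ≡ v

  isPairAt? : (v : Fin n) → Decidable (IsPairAt v)
  isPairAt? v (loop _)     = no λ ()
  isPairAt? v (pair a b _) = a ≟ v ⊎-dec b ≟ v

  Incident : Fin n → Pred (Edge n) 0ℓ
  Incident v = IsLoopAt v ∪ IsPairAt v

  incident? : (v : Fin n) → Decidable (Incident v)
  incident? v = isLoopAt? v ∪? isPairAt? v

  Touches : List (Fin n) → Pred (Edge n) 0ℓ
  Touches vs x = Any (λ u → Incident u x) vs

  touches-allFin : (x : Edge n) → Touches (allFin n) x
  touches-allFin (loop u)     = lose (∈-allFin u) (inj₁ refl)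
  touches-allFin (pair a _ _) = lose (∈-allFin a) (inj₂ (inj₁ refl))

  other-endpoint : ∀ {v x} → IsPairAt v x → ∃[ w ] w ≢ v × IsPairAt w x
  other-endpoint {x = pair a b a≢b} (inj₁ refl) = b , a≢b ∘ sym , inj₂ refl
  other-endpoint {x = pair a b a≢b} (inj₂ refl) = a , a≢b , inj₁ refl

  loop-not-incident : ∀ {v w x} → w ≢ v → IsLoopAt v x → ¬ Incident w x
  loop-not-incident {x = loop _} w≢v refl (inj₁ refl) = w≢v refl

  Kept : (Fin n → Bool) → Pred (Edge n) 0ℓ
  Kept s (loop u)     = T (s u)
  Kept s (pair a b _) = ¬ (T (s a) × T (s b))

  kept? : (s : Fin n → Bool) → Decidable (Kept s)
  kept? s (loop u)     = T? (s u)
  kept? s (pair a b _) = ¬? (T? (s a) ×-dec T? (s b))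

  kept-resp : ∀ {s t} x → (∀ {u} → Incident u x → s u ≡ t u) → Kept s x → Kept t x
  kept-resp (loop u)     s≡t kept          = subst T (s≡t (inj₁ refl)) kept
  kept-resp (pair a b _) s≡t kept (ta , tb) =
    kept (subst T (sym (s≡t (inj₂ (inj₁ refl)))) ta , subst T (sym (s≡t (inj₂ (inj₂ refl)))) tb)

  pair-kept : ∀ {s v x} → s v ≡ false → IsPairAt v x → Kept s x
  pair-kept {x = pair _ _ _} sv≡false (inj₁ refl) (ta , _) = subst T sv≡false ta
  pair-kept {x = pair _ _ _} sv≡false (inj₂ refl) (_ , tb) = subst T sv≡false tb

  loop-kept : ∀ {s v x} → s v ≡ true → IsLoopAt v x → Kept s x
  loop-kept {x = loop _} sv≡true refl = subst T (sym sv≡true) _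

  kept-dumbbellFree : ∀ s (G : Hypergraph n) → DumbbellFree (filter (kept? s) G)
  kept-dumbbellFree s G (x , y , x∈ , y∈ , pair _ _ _ , f∈ , refl , refl) =
    kept-of f∈ (kept-of x∈ , kept-of y∈)
    where
    kept-of : ∀ {f} → f ∈ filter (kept? s) G → Kept s f
    kept-of = proj₂ ∘ ∈-filter⁻ (kept? s) {xs = G}

module _ {n : ℕ} (G : Hypergraph n) (atMostOneLoop : AtMostOneLoop G) where

  private variable
    p : Level
    R : Pred (Edge n) 0ℓ

  #_ : {P : Pred (Edge n) p} → Decidable P → ℕ
  # P? = count P? G

  loops degree : Decidable R → Fin n → ℕ
  loops  R? v = # (R? ∩? isLoopAt? v)
  degree R? v = # (R? ∩? isPairAt? v)

  -- R marks the edges of G not yet retired.  The surplus c lets one step run a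
  -- deficit that a later step makes up.
  Solution : ℕ → Decidable R → Set
  Solution c R? = Σ (Fin n → Bool) λ s → 2 * # R? + c ≤ 3 * # (R? ∩? kept? s)

  loops≤1 : (R? : Decidable R) (v : Fin n) → loops R? v ≤ 1
  loops≤1 R? v = ≤-trans (count-mono _ (isLoopAt? v) proj₂ G) (atMostOneLoop v)

  star-size : (R? : Decidable R) (v : Fin n) →
              # (R? ∩? incident? v) ≤ loops R? v + degree R? v
  star-size R? v = count-≤-+ _ _ _ (λ (r , i) → Sum.map (r ,_) (r ,_) i) G

  degree≤kept : (R? : Decidable R) {s : Fin n → Bool} {v : Fin n} → s v ≡ false →
                degree R? v ≤ # ((R? ∩? kept? s) ∩? incident? v)
  degree≤kept R? sv≡false = count-mono _ _ (λ (r , d) → (r , pair-kept sv≡false d) , inj₂ d) G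

  loops≤kept : (R? : Decidable R) {s : Fin n → Bool} {v : Fin n} → s v ≡ true →
               loops R? v ≤ # ((R? ∩? kept? s) ∩? incident? v)
  loops≤kept R? sv≡true = count-mono _ _ (λ (r , l) → (r , loop-kept sv≡true l) , inj₁ l) G

  extend : ∀ {c c′} (R? : Decidable R) (v : Fin n) (b : Bool) →
           (∀ s → s v ≡ b →
              2 * # (R? ∩? incident? v) + c ≤ 3 * # ((R? ∩? kept? s) ∩? incident? v) + c′) →
           Solution c′ (R? ∩? ∁? (incident? v)) → Solution c R?
  extend {c = c} {c′} R? v b star-bound (s′ , rest-bound) =
    s , subst₂ (λ k m → 2 * k + c ≤ 3 * m)
               (sym (count-split R? (incident? v) G))
               (sym (count-split (R? ∩? kept? s) (incident? v) G))
               (combine {# (R? ∩? incident? v)} {# (R? ∩? ∁? (incident? v))}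
                        {# ((R? ∩? kept? s) ∩? incident? v)} {# ((R? ∩? kept? s) ∩? ∁? (incident? v))}
                        (star-bound s (updateAt-updates v s′))
                        (subst (λ m → _ ≤ 3 * m) (count-≐ _ _ rest-≐ G) rest-bound))
    where
    s : Fin n → Bool
    s = updateAt s′ v (const b)
    s≡s′ : ∀ {x u} → ¬ Incident v x → Incident u x → s u ≡ s′ u
    s≡s′ ¬iv iu = updateAt-minimal _ v s′ λ { refl → ¬iv iu }
    rest-≐ : (R ∩ ∁ (Incident v)) ∩ Kept s′ ≐ (R ∩ Kept s) ∩ ∁ (Incident v)
    rest-≐ = (λ {x} ((r , ¬iv) , k) → (r , kept-resp x (sym ∘ s≡s′ ¬iv) k) , ¬iv)
           , (λ {x} ((r , k) , ¬iv) → (r , ¬iv) , kept-resp x (s≡s′ ¬iv) k)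

  drop-loop-at : ∀ {c c′} (R? : Decidable R) (v : Fin n) →
                 2 * (loops R? v + degree R? v) + c ≤ 3 * degree R? v + c′ →
                 Solution c′ (R? ∩? ∁? (incident? v)) → Solution c R?
  drop-loop-at {c = c} {c′} R? v pays = extend R? v false λ s sv≡false → begin
    2 * # (R? ∩? incident? v) + c        ≤⟨ +-monoˡ-≤ c (*-monoʳ-≤ 2 (star-size R? v)) ⟩
    2 * (loops R? v + degree R? v) + c   ≤⟨ pays ⟩
    3 * degree R? v + c′                 ≤⟨ +-monoˡ-≤ c′ (*-monoʳ-≤ 3 (degree≤kept R? sv≡false)) ⟩
    3 * # ((R? ∩? kept? s) ∩? incident? v) + c′ ∎
    where open ≤-Reasoning

  keep-loop-at : ∀ {c c′} (R? : Decidable R) (v : Fin n) →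
                 2 * (loops R? v + degree R? v) + c ≤ 3 * loops R? v + c′ →
                 Solution c′ (R? ∩? ∁? (incident? v)) → Solution c R?
  keep-loop-at {c = c} {c′} R? v pays = extend R? v true λ s sv≡true → begin
    2 * # (R? ∩? incident? v) + c        ≤⟨ +-monoˡ-≤ c (*-monoʳ-≤ 2 (star-size R? v)) ⟩
    2 * (loops R? v + degree R? v) + c   ≤⟨ pays ⟩
    3 * loops R? v + c′                  ≤⟨ +-monoˡ-≤ c′ (*-monoʳ-≤ 3 (loops≤kept R? sv≡true)) ⟩
    3 * # ((R? ∩? kept? s) ∩? incident? v) + c′ ∎
    where open ≤-Reasoning

  pendant-loop : (R? : Decidable R) (v : Fin n) → loops R? v ≡ 1 → degree R? v ≡ 1 →
                 (∀ w → Solution 0 ((R? ∩? ∁? (incident? w)) ∩? ∁? (incident? v))) →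
                 Solution 0 R?
  pendant-loop {R} R? v loops≡1 degree≡1 solve-rest
    with f , f∈G , Rf , vf ← count-witness (R? ∩? isPairAt? v) G (≤-reflexive (sym degree≡1))
    with w , w≢v , wf ← other-endpoint vf
    = drop-loop-at R? w (neighbour-arith (loops≤1 R? w) w-has-pair)
        (keep-loop-at R′? v (pendant-arith loops′≡1 degree′≡0) (solve-rest w))
    where
    open ≤-Reasoning
    R′? : Decidable (R ∩ ∁ (Incident w))
    R′? = R? ∩? ∁? (incident? w)
    w-has-pair : 1 ≤ degree R? w
    w-has-pair = filter-some (R? ∩? isPairAt? w) (lose f∈G (Rf , wf))
    loops′≡1 : loops R′? v ≡ 1
    loops′≡1 = trans (count-≐ _ _ loops-unchanged G) loops≡1
      where
      loops-unchanged : (R ∩ ∁ (Incident w)) ∩ IsLoopAt v ≐ R ∩ IsLoopAt v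
      loops-unchanged = (λ ((r , _) , l) → r , l) , (λ (r , l) → (r , loop-not-incident w≢v l) , l)
    degree′≡0 : degree R′? v ≡ 0
    degree′≡0 = n≤0⇒n≡0 (begin
      degree R′? v
        ≤⟨ count-mono _ _ (λ ((r , ¬iw) , d) → (r , d) , ¬iw) G ⟩
      # ((R? ∩? isPairAt? v) ∩? ∁? (incident? w))
        ≡⟨ count-∩∁≡0 (R? ∩? isPairAt? v) (incident? w)
                      (≤-reflexive degree≡1) f∈G (Rf , vf) (inj₂ wf) ⟩
      0 ∎)

  solve : (vs : List (Fin n)) (R? : Decidable R) → R Unary.⊆ Touches vs → Solution 0 R?
  solve []       R? covered =
    const false , ≤-trans (≤-reflexive (cong (λ k → 2 * k + 0) nothing-left)) z≤n
    where
    nothing-left : # R? ≡ 0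
    nothing-left = count-none R? (¬Any[] ∘ covered) G
  solve (v ∷ vs) R? covered with loop-degree-cases (loops R? v) (degree R? v) (loops≤1 R? v)
  ... | inj₁ dropping-pays =
    drop-loop-at R? v dropping-pays (solve vs _ λ (r , ¬iv) → Any.tail ¬iv (covered r))
  ... | inj₂ (inj₁ keeping-pays) =
    keep-loop-at R? v keeping-pays (solve vs _ λ (r , ¬iv) → Any.tail ¬iv (covered r))
  ... | inj₂ (inj₂ (ℓ≡1 , d≡1)) =
    pendant-loop R? v ℓ≡1 d≡1 λ w → solve vs _ λ ((r , _) , ¬iv) → Any.tail ¬iv (covered r)

  kept-two-thirds : ∃[ s ] 2 * e G ≤ 3 * e (filter (kept? s) G)
  kept-two-thirds with s , bound ← solve (allFin n) U? (λ {x} _ → touches-allFin x) = s , (begin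
    2 * e G                      ≡⟨ cong (λ H → 2 * length H) (filter-all U? (universal-U G)) ⟨
    2 * # U?                     ≡⟨ +-identityʳ _ ⟨
    2 * # U? + 0                 ≤⟨ bound ⟩
    3 * # (U? ∩? kept? s)        ≡⟨ cong (3 *_) (count-≐ _ _ (proj₂ , (_ ,_)) G) ⟩
    3 * e (filter (kept? s) G)   ∎)
    where open ≤-Reasoning

theorem4p4 : (n : ℕ) (G : Hypergraph n) → AtMostOneLoop G →
    Σ (Hypergraph n) λ H → (H ⊆ G) × DumbbellFree H × (2 * e G ≤ 3 * e H)
theorem4p4 n G atMostOneLoop with s , bound ← kept-two-thirds G atMostOneLoop =
  filter (kept? s) G , filter-⊆ (kept? s) G , kept-dumbbellFree s G , bound
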